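{- For all positive integers $k$ and $c$, $\operatorname{osat}_{\mathcal G}(k;c)\le 48k^2c^{k^2}$.
   Context: Let $\mathcal G$ be the family of finite complete graphs whose edges are each coloured with one of $c$ colours $1,\dots,c$. For $G,G'\in\mathcal G$, $G'$ extends $G$ if $G$ is a proper subgraph of $G'$ with the same edge colours (i.e. $G'$ is obtained by adding new vertices and coloured edges from them to all other vertices). A graph $G\in\mathcal G$ is semisaturated (for $K_k$ in every colour) if every $G'\in\mathcal G$ extending $G$ contains, for some colour $i$, a monochromatic $K_k$ of colour $i$ not contained in $G$. $\operatorname{osat}_{\mathcal G}(k;c)$ is the minimum number of vertices of such a semisaturated graph. -}

module Defs where

open import Data.Nat using (ℕ; suc; _+_; _≤_)
open import Data.Fin using (Fin; toℕ; _↑ˡ_)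
open import Data.Product using (Σ; ∃; _×_)
open import Relation.Binary.PropositionalEquality using (_≡_; _≢_)
open import Function.Definitions using (Injective)

-- The colour of edge {u,v} (u ≢ v) is col u v; diagonal
-- values col u u are irrelevant and never used.
record ColouredKn (n c : ℕ) : Set where
  field
    col : Fin n → Fin n → Fin c
    sym : ∀ u v → u ≢ v → col u v ≡ col v u
open ColouredKn public

-- G' (on n + suc m vertices) extends G (on n vertices): G sits on the first
-- n vertices of G' (via _↑ˡ_) with the same edge colours, and at least one
-- new vertex is added (so G is a proper subgraph).
Extends : ∀ {n m c} → ColouredKn (n + suc m) c → ColouredKn n c → Set
Extends {n} {m} G' G =
  ∀ (u v : Fin n) → u ≢ v → col G' (u ↑ˡ suc m) (v ↑ˡ suc m) ≡ col G u v

MonoClique : ∀ {N c} → ColouredKn N c → (k : ℕ) → Fin c → (Fin k → Fin N) → Set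
MonoClique G k i f =
  Injective _≡_ _≡_ f × (∀ a b → a ≢ b → col G (f a) (f b) ≡ i)

-- G (n vertices) is semisaturated for K_k in every colour: every extension G'
-- contains, for some colour i, a monochromatic K_k of colour i not contained
-- in G (i.e. using at least one vertex outside the first n).
Semisaturated : ∀ {n c} → (k : ℕ) → ColouredKn n c → Set
Semisaturated {n} {c} k G =
  ∀ (m : ℕ) (G' : ColouredKn (n + suc m) c) → Extends G' G →
    Σ (Fin c) λ i → Σ (Fin k → Fin (n + suc m)) λ f →
      MonoClique G' k i f × Σ (Fin k) (λ a → n ≤ toℕ (f a))

-- osat_G(k;c) ≤ B  iff  some semisaturated graph has at most B vertices
-- (osat is the minimum of such vertex counts).
OsatLE : (k c B : ℕ) → Set
OsatLE k c B = Σ ℕ λ n → n ≤ B × Σ (ColouredKn n c) λ G → Semisaturated k G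

-- For K_{j+2} take the q × (c+1)q grid with q = 2(c+1)j + 1, and colour the edge
-- uv by the slope s ≤ c of a line y + s·x = b through u and v (unique when u and
-- v lie in different columns), or by 0 if there is none. A new vertex gives each
-- grid point u the colour g u of its edge to u, and hence the line through u of
-- slope g u. There are fewer than (#points)/j such lines, so by the generalised
-- pigeonhole principle some j + 1 points pick the same line, of slope s say:
-- they span a K_{j+1} of colour s, which the new vertex completes to a K_{j+2}.
-- For K_1 the empty graph works.
module Submission where

open import Defs
open import Data.Nat using (ℕ; suc; _*_; _^_)
open import Data.Nat.Base using (zero; _+_; _≤_; _<_; z≤n; s≤s; s≤s⁻¹)
open import Data.Nat.Properties
  using (_≟_; <-cmp; +-cancelˡ-≡; +-cancelʳ-≡; *-cancelʳ-≡; m≤m+n; m<m+n; <⇒≢; <⇒≱;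
         ≤-refl; ≤-trans; <⇒≤; +-mono-<-≤; *-mono-≤; *-monoˡ-≤; ^-monoʳ-≤; m≤n⇒∃[o]m+o≡n; module ≤-Reasoning)
open import Data.Nat.Tactic.RingSolver using (solve-∀)
open import Data.Fin.Base using (Fin; zero; suc; toℕ; fromℕ<; combine; remQuot; _↑ˡ_; _↑ʳ_)
import Data.Fin.Properties as Fin
open import Data.Fin.Properties
  using (suc-injective; toℕ-injective; toℕ<n; toℕ-↑ˡ; toℕ-↑ʳ; ↑ˡ-injective; toℕ-fromℕ<;
         combine-injective; combine-remQuot; any?; all?; ¬∀⟶∃¬; injective⇒≤)
open import Data.Product using (Σ; ∃; _×_; _,_; proj₁; proj₂; uncurry)
open import Data.Sum using (_⊎_; inj₁; inj₂)
open import Data.Vec.Functional using (_∷_)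
open import Function using (_∘_)
open import Function.Definitions using (Injective)
open import Relation.Nullary using (Dec; yes; no; contradiction)
open import Relation.Nullary.Decidable using (_×-dec_)
open import Relation.Binary using (tri<; tri≈; tri>)
open import Relation.Binary.PropositionalEquality as ≡ using (_≡_; _≢_; refl; cong; cong₂; trans; subst)

CommonFibre : ∀ {n m} → (Fin n → Fin m) → ℕ → Set
CommonFibre {n} {m} f k =
  Σ (Fin m) λ a → Σ (Fin k → Fin n) λ h → Injective _≡_ _≡_ h × (∀ r → f (h r) ≡ a)

Ranking : ∀ {n m} → (Fin n → Fin m) → ℕ → Set
Ranking {n} f j =
  Σ (Fin n → Fin j) λ rank → ∀ i i' → f i ≡ f i' → rank i ≡ rank i' → i ≡ i'

ranking⇒≤ : ∀ {n m j} (f : Fin n → Fin m) → Ranking f j → n ≤ m * j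
ranking⇒≤ f (rank , rank-inj) = injective⇒≤ λ {i} {i'} e →
  let (same-value , same-rank) = combine-injective (f i) (rank i) (f i') (rank i') e
  in rank-inj i i' same-value same-rank

-- The point 0 takes a rank unused in its fibre; if all j ranks are used, their
-- owners together with 0 are j + 1 points of that fibre.
extend-ranking : ∀ {n m j} (f : Fin (suc n) → Fin m) →
  Ranking (f ∘ suc) j → CommonFibre f (suc j) ⊎ Ranking f j
extend-ranking {n} {m} {j} f (rank , rank-inj) = by-cases (all? taken?)
  where
  Taken : Fin j → Set
  Taken r = ∃ λ i → f (suc i) ≡ f zero × rank i ≡ r

  taken? : ∀ r → Dec (Taken r)
  taken? r = any? λ i → (f (suc i) Fin.≟ f zero) ×-dec (rank i Fin.≟ r)

  by-cases : Dec (∀ r → Taken r) → CommonFibre f (suc j) ⊎ Ranking f j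
  by-cases (yes taken) = inj₁ (f zero , owner , owner-injective , owner-fibre)
    where
    owner : Fin (suc j) → Fin (suc n)
    owner = zero ∷ λ r → suc (proj₁ (taken r))
    owner-injective : Injective _≡_ _≡_ owner
    owner-injective {zero} {zero} _ = refl
    owner-injective {suc r} {suc r'} e = cong suc (begin
      r                        ≡⟨ proj₂ (proj₂ (taken r)) ⟨
      rank (proj₁ (taken r))   ≡⟨ cong rank (suc-injective e) ⟩
      rank (proj₁ (taken r'))  ≡⟨ proj₂ (proj₂ (taken r')) ⟩
      r'                       ∎)
      where open ≡.≡-Reasoning
    owner-fibre : ∀ r → f (owner r) ≡ f zero
    owner-fibre zero = refl
    owner-fibre (suc r) = proj₁ (proj₂ (taken r))
  by-cases (no ¬all-taken) with ¬∀⟶∃¬ j Taken taken? ¬all-taken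
  ... | free , free-unused = inj₂ (free ∷ rank , rank′-injective)
    where
    rank′-injective : ∀ i i' → f i ≡ f i' → (free ∷ rank) i ≡ (free ∷ rank) i' → i ≡ i'
    rank′-injective zero zero _ _ = refl
    rank′-injective zero (suc i) ef er = contradiction (i , ≡.sym ef , ≡.sym er) free-unused
    rank′-injective (suc i) zero ef er = contradiction (i , ef , er) free-unused
    rank′-injective (suc i) (suc i') ef er = cong suc (rank-inj i i' ef er)

commonFibre⊎ranking : ∀ {n m} j (f : Fin n → Fin m) → CommonFibre f (suc j) ⊎ Ranking f j
commonFibre⊎ranking {zero} j f = inj₂ ((λ ()) , λ ())
commonFibre⊎ranking {suc n} j f with commonFibre⊎ranking j (f ∘ suc)
... | inj₁ (a , h , h-inj , h-fibre) = inj₁ (a , suc ∘ h , h-inj ∘ suc-injective , h-fibre)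
... | inj₂ ranking = extend-ranking f ranking

pigeonhole-fibre : ∀ {n m} j (f : Fin n → Fin m) → m * j < n → CommonFibre f (suc j)
pigeonhole-fibre j f m*j<n with commonFibre⊎ranking j f
... | inj₁ fibre = fibre
... | inj₂ ranking = contradiction (ranking⇒≤ f ranking) (<⇒≱ m*j<n)

slope-unique-< : ∀ {x₁ x₂ y₁ y₂} s t → x₁ < x₂ →
  y₁ + s * x₁ ≡ y₂ + s * x₂ → y₁ + t * x₁ ≡ y₂ + t * x₂ → s ≡ t
slope-unique-< {x₁} {y₁ = y₁} {y₂} s t x₁<x₂ es et with m≤n⇒∃[o]m+o≡n x₁<x₂
... | d , refl = *-cancelʳ-≡ s t (suc d) (+-cancelˡ-≡ y₂ _ _ (trans (≡.sym (rise s es)) (rise t et)))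
  where
  shift : ∀ y u x d → y + u * suc (x + d) ≡ (y + u * suc d) + u * x
  shift = solve-∀
  rise : ∀ u → y₁ + u * x₁ ≡ y₂ + u * suc (x₁ + d) → y₁ ≡ y₂ + u * suc d
  rise u e = +-cancelʳ-≡ (u * x₁) y₁ _ (trans e (shift y₂ u x₁ d))

slope-unique : ∀ {x₁ x₂ y₁ y₂} s t → x₁ ≢ x₂ →
  y₁ + s * x₁ ≡ y₂ + s * x₂ → y₁ + t * x₁ ≡ y₂ + t * x₂ → s ≡ t
slope-unique {x₁} {x₂} s t x₁≢x₂ es et with <-cmp x₁ x₂
... | tri< x₁<x₂ _ _ = slope-unique-< s t x₁<x₂ es et
... | tri≈ _ x₁≡x₂ _ = contradiction x₁≡x₂ x₁≢x₂
... | tri> _ _ x₂<x₁ = slope-unique-< s t x₂<x₁ (≡.sym es) (≡.sym et)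

↑ˡ≢↑ʳ : ∀ {m n} (i : Fin m) (j : Fin n) → i ↑ˡ n ≢ m ↑ʳ j
↑ˡ≢↑ʳ {m} {n} i j e = <⇒≢ (begin-strict
  toℕ (i ↑ˡ n)  ≡⟨ toℕ-↑ˡ i n ⟩
  toℕ i         <⟨ toℕ<n i ⟩
  m             ≤⟨ m≤m+n m (toℕ j) ⟩
  m + toℕ j     ≡⟨ toℕ-↑ʳ m j ⟨
  toℕ (m ↑ʳ j)  ∎) (cong toℕ e)
  where open ≤-Reasoning

-- g colours the edges from a new vertex to G.
ForcesCone : ∀ {n c} → ℕ → ColouredKn n c → Set
ForcesCone {n} {c} k G = ∀ (g : Fin n → Fin c) →
  Σ (Fin c) λ s → Σ (Fin k → Fin n) λ f → MonoClique G k s f × (∀ a → g (f a) ≡ s)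

cone-clique : ∀ {n m c k s} {G : ColouredKn n c} {G' : ColouredKn (n + suc m) c}
  {f : Fin k → Fin n} → Extends G' G → MonoClique G k s f →
  (∀ a → col G' (n ↑ʳ zero) (f a ↑ˡ suc m) ≡ s) →
  MonoClique G' (suc k) s ((n ↑ʳ zero) ∷ λ a → f a ↑ˡ suc m)
cone-clique {n} {m} {k = k} {s} {G' = G'} {f} ext (f-inj , f-mono) f-apex = clique-inj , clique-mono
  where
  clique : Fin (suc k) → Fin (n + suc m)
  clique = (n ↑ʳ zero) ∷ λ a → f a ↑ˡ suc m
  clique-inj : Injective _≡_ _≡_ clique
  clique-inj {zero} {zero} _ = refl
  clique-inj {zero} {suc b} e = contradiction (≡.sym e) (↑ˡ≢↑ʳ (f b) zero)
  clique-inj {suc a} {zero} e = contradiction e (↑ˡ≢↑ʳ (f a) zero)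
  clique-inj {suc a} {suc b} e = cong suc (f-inj (↑ˡ-injective (suc m) (f a) (f b) e))
  clique-mono : ∀ a b → a ≢ b → col G' (clique a) (clique b) ≡ s
  clique-mono zero zero a≢b = contradiction refl a≢b
  clique-mono zero (suc b) _ = f-apex b
  clique-mono (suc a) zero _ = trans (ColouredKn.sym G' _ _ (↑ˡ≢↑ʳ (f a) zero)) (f-apex a)
  clique-mono (suc a) (suc b) a≢b =
    trans (ext (f a) (f b) (a≢b ∘ cong suc ∘ f-inj)) (f-mono a b (a≢b ∘ cong suc))

forcesCone⇒semisaturated : ∀ {n c k} {G : ColouredKn n c} → ForcesCone k G → Semisaturated (suc k) G
forcesCone⇒semisaturated {n} {G = G} cone m G' ext =
  let s , f , f-mono , f-apex = cone λ u → col G' (n ↑ʳ zero) (u ↑ˡ suc m)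
  in s , _ , cone-clique {G = G} {G' = G'} ext f-mono f-apex , zero , apex-outside
  where
  apex-outside : n ≤ toℕ (n ↑ʳ zero {m})
  apex-outside = subst (n ≤_) (≡.sym (toℕ-↑ʳ n zero)) (m≤m+n n 0)

module Grid (p r c : ℕ) where

  Point : Set
  Point = Fin (p * r)

  column row : Point → ℕ
  column u = toℕ (proj₁ (remQuot {p} r u))
  row u = toℕ (proj₂ (remQuot {p} r u))

  height : ℕ → Point → ℕ
  height s u = row u + s * column u

  coordinates-injective : ∀ {u v} → column u ≡ column v → row u ≡ row v → u ≡ v
  coordinates-injective {u} {v} ex ey = begin
    u                                ≡⟨ combine-remQuot {p} r u ⟨
    uncurry combine (remQuot {p} r u) ≡⟨ cong₂ combine (toℕ-injective ex) (toℕ-injective ey) ⟩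
    uncurry combine (remQuot {p} r v) ≡⟨ combine-remQuot {p} r v ⟩
    v                                ∎
    where open ≡.≡-Reasoning

  column-injective-on-line : ∀ {u v} s → column u ≡ column v → height s u ≡ height s v → u ≡ v
  column-injective-on-line {u} {v} s ex e = coordinates-injective ex
    (+-cancelʳ-≡ (s * column u) (row u) (row v) (trans e (cong (λ x → row v + s * x) (≡.sym ex))))

  height< : ∀ {s} u → s ≤ c → height s u < r + c * p
  height< u s≤c = +-mono-<-≤ (toℕ<n (proj₂ (remQuot {p} r u)))
    (*-mono-≤ s≤c (<⇒≤ (toℕ<n (proj₁ (remQuot {p} r u)))))

  commonLine? : ∀ u v → Dec (∃ λ (s : Fin (suc c)) → height (toℕ s) u ≡ height (toℕ s) v)
  commonLine? u v = any? λ s → height (toℕ s) u ≟ height (toℕ s) v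

  slope : Point → Point → Fin (suc c)
  slope u v with commonLine? u v
  ... | yes (s , _) = s
  ... | no _ = zero

  slope-on-line : ∀ {u v} s → column u ≢ column v → height (toℕ s) u ≡ height (toℕ s) v → slope u v ≡ s
  slope-on-line {u} {v} s ex≢ e with commonLine? u v
  ... | yes (t , e′) = toℕ-injective (slope-unique (toℕ t) (toℕ s) ex≢ e′ e)
  ... | no none = contradiction (s , e) none

  slope-sym : ∀ {u v} → u ≢ v → slope u v ≡ slope v u
  slope-sym {u} {v} u≢v with commonLine? u v
  ... | yes (s , e) = ≡.sym (slope-on-line s columns-differ (≡.sym e))
    where
    columns-differ : column v ≢ column u
    columns-differ ex = u≢v (≡.sym (column-injective-on-line (toℕ s) ex (≡.sym e)))
  ... | no none with commonLine? v u
  ...   | yes (t , e) = contradiction (t , ≡.sym e) none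
  ...   | no _ = refl

  grid : ColouredKn (p * r) (suc c)
  grid = record { col = slope ; sym = λ _ _ → slope-sym }

  -- the line of slope g u through u, encoded by its slope and height
  line : (Point → Fin (suc c)) → Point → Fin (suc c * (r + c * p))
  line g u = combine (g u) (fromℕ< (height< u (s≤s⁻¹ (toℕ<n (g u)))))

  line-injective : ∀ g {u v} → line g u ≡ line g v →
    g u ≡ g v × height (toℕ (g u)) u ≡ height (toℕ (g v)) v
  line-injective g {u} {v} e with combine-injective (g u) _ (g v) _ e
  ... | same-colour , same-height = same-colour , (begin
    height (toℕ (g u)) u  ≡⟨ toℕ-fromℕ< _ ⟨
    toℕ (fromℕ< _)        ≡⟨ cong toℕ same-height ⟩
    toℕ (fromℕ< _)        ≡⟨ toℕ-fromℕ< _ ⟩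
    height (toℕ (g v)) v  ∎)
    where open ≡.≡-Reasoning

  same-line⇒slope : ∀ g {u v} → u ≢ v → line g u ≡ line g v → slope u v ≡ g u
  same-line⇒slope g {u} {v} u≢v e with line-injective g e
  ... | same-colour , same-height =
    slope-on-line (g u) (λ ex → u≢v (column-injective-on-line (toℕ (g u)) ex on-line)) on-line
    where
    on-line : height (toℕ (g u)) u ≡ height (toℕ (g u)) v
    on-line = trans same-height (cong (λ s → height (toℕ s) v) (≡.sym same-colour))

  grid-forcesCone : ∀ j → suc c * (r + c * p) * j < p * r → ForcesCone (suc j) grid
  grid-forcesCone j few-lines g with pigeonhole-fibre j (line g) few-lines
  ... | _ , h , h-inj , h-line = g (h zero) , h , (h-inj , on-line) , same-colour
    where
    same-line : ∀ i i' → line g (h i) ≡ line g (h i')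
    same-line i i' = trans (h-line i) (≡.sym (h-line i'))
    same-colour : ∀ i → g (h i) ≡ g (h zero)
    same-colour i = proj₁ (line-injective g (same-line i zero))
    on-line : ∀ i i' → i ≢ i' → slope (h i) (h i') ≡ g (h zero)
    on-line i i' i≢i' = trans (same-line⇒slope g (i≢i' ∘ h-inj) (same-line i i')) (same-colour i)

lines*j<points : ∀ c j → let q = suc (2 * suc c * j) in
  suc c * (suc c * q + c * q) * j < q * (suc c * q)
lines*j<points c j = subst (lines*j <_) (expand c j) (m<m+n lines*j (s≤s z≤n))
  where
  lines*j = suc c * (suc c * suc (2 * suc c * j) + c * suc (2 * suc c * j)) * j
  expand : ∀ c j →
    suc c * (suc c * suc (2 * suc c * j) + c * suc (2 * suc c * j)) * j
      + suc c * suc (2 * suc c * j) * suc j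
    ≡ suc (2 * suc c * j) * (suc c * suc (2 * suc c * j))
  expand = solve-∀

grid-size≤bound : ∀ c j → let q = suc (2 * suc c * j); K = suc (suc j) in
  q * (suc c * q) ≤ 48 * (K * K) * suc c ^ (K * K)
grid-size≤bound c j = begin
  q * (C * q)                    ≤⟨ *-mono-≤ q≤2CK (*-mono-≤ {C} ≤-refl q≤2CK) ⟩
  2 * C * K * (C * (2 * C * K))  ≡⟨ regroup C K ⟩
  4 * (K * K) * C ^ 3            ≤⟨ *-mono-≤ (*-monoˡ-≤ (K * K) (m≤m+n 4 44)) (^-monoʳ-≤ C 3≤K*K) ⟩
  48 * (K * K) * C ^ (K * K)     ∎
  where
  open ≤-Reasoning
  C = suc c
  K = suc (suc j)
  q = suc (2 * C * j)
  q≤2CK : q ≤ 2 * C * K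
  q≤2CK = subst (q ≤_) (≡.sym (spread c j)) (m≤m+n q _)
    where
    spread : ∀ c j → 2 * suc c * suc (suc j) ≡ suc (2 * suc c * j) + (3 + 4 * c)
    spread = solve-∀
  regroup : ∀ C K → 2 * C * K * (C * (2 * C * K)) ≡ 4 * (K * K) * (C * (C * (C * 1)))
  regroup = solve-∀
  3≤K*K : 3 ≤ K * K
  3≤K*K = ≤-trans (s≤s (s≤s (s≤s z≤n))) (*-mono-≤ {2} {K} {2} {K} (s≤s (s≤s z≤n)) (s≤s (s≤s z≤n)))

theorem2 : (k c : ℕ) → OsatLE (suc k) (suc c) (48 * (suc k * suc k) * (suc c ^ (suc k * suc k)))
theorem2 zero c = 0 , z≤n , empty , forcesCone⇒semisaturated {G = empty} K₁-cone
  where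
  empty : ColouredKn 0 (suc c)
  empty = record { col = λ () ; sym = λ () }
  K₁-cone : ForcesCone 0 empty
  K₁-cone _ = zero , (λ ()) , ((λ { {()} }) , λ ()) , λ ()
theorem2 (suc j) c =
  q * (suc c * q) , grid-size≤bound c j , grid ,
  forcesCone⇒semisaturated {G = grid} (grid-forcesCone j (lines*j<points c j))
  where
  q = suc (2 * suc c * j)
  open Grid q (suc c * q) c
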